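{- Let $G=(V,E)$ be a finite simple graph with $|V|=n$, let $S\subseteq V$, and let $G'=G-S$ be the induced subgraph on $V\setminus S$. Then $$P_G(x)=P_{G'}(x)-R_S(x)+U_S(x),$$ where $$U_S(x)=\sum_{\substack{I\in\mathcal I(G)\\ I\cap S\ne\varnothing}} w_G(I)\,x^{|I|},\qquad R_S(x)=\sum_{I\in\mathcal I(G')}\bigl(w_{G'}(I)-w_G(I)\bigr)x^{|I|}.$$ Moreover: (i) $\mathcal I(G')=\{I\in\mathcal I(G): I\cap S=\varnothing\}$; (ii) for every $I\in\mathcal I(G')$, $|N_{G'}[I]|=|N_G[I]|-|N_G[I]\cap S|$, and consequently $a_{G'}(I)=a_G(I)-\bigl(|S|-|N_G[I]\cap S|\bigr)$; (iii) setting $\Delta b_I=b_{G'}(I)-b_G(I)$ for $I\in\mathcal I(G')$ (so $\Delta b_\varnothing=0$), for every nonempty $I\in\mathcal I(G')$, $$|N_{G'}[I]|\,\Delta b_I=\sum_{v\in I}\Delta b_{I\setminus\{v\}}+|N_G[I]\cap S|\,b_G(I),$$ and in particular the values $\Delta b_I$ are uniquely determined by induction on $|I|$.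
   Context: For a finite graph $H$ with vertex set $W$, $|W|=m$: $\mathcal I(H)$ is the family of independent sets (sets with no two adjacent vertices, including $\varnothing$); for $I\subseteq W$, $N_H(I)$ is the set of vertices adjacent in $H$ to some vertex of $I$, $N_H[I]=I\cup N_H(I)$, and $a_H(I)=|W\setminus N_H[I]|$. Define $b_H$ on $\mathcal I(H)$ by $b_H(\varnothing)=1$ and $b_H(I)=\frac{1}{m-a_H(I)}\sum_{v\in I}b_H(I\setminus\{v\})=\frac{1}{|N_H[I]|}\sum_{v\in I}b_H(I\setminus\{v\})$ for $I\ne\varnothing$; set $w_H(I)=\frac{a_H(I)}{m}b_H(I)$ and $P_H(x)=\sum_{I\in\mathcal I(H)}w_H(I)x^{|I|}$ (the successive ordering polynomial of $H$). These are applied with $H=G$ ($m=n$) and $H=G'$ ($m=n-|S|$). -}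

module Defs where

open import Data.Nat as ℕ using (ℕ; zero; suc)
open import Data.Bool using (Bool; true; false; _∧_; _∨_; not; if_then_else_; T)
open import Data.Fin using (Fin)
open import Data.Vec using (Vec; []; _∷_; lookup; tabulate)
open import Data.List using (List; []; _∷_; _++_; map; foldr)
open import Data.Integer as ℤ using (ℤ)
open import Data.Rational as ℚ using (ℚ; 0ℚ; 1ℚ; _+_; _*_; _-_)
open import Data.Fin.Subset using (Subset; ∣_∣; _─_; ⁅_⁆; _∩_; ⊤; inside; outside)
open import Relation.Binary.PropositionalEquality using (_≡_)

record SimpleGraph (n : ℕ) : Set where
  field
    adj   : Fin n → Fin n → Bool
    sym   : ∀ u v → adj u v ≡ adj v u
    irref : ∀ v → adj v v ≡ false
open SimpleGraph public

-- A graph H is represented as a pair (G , W) : the subgraph of G induced on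
-- the vertex set W ⊆ V(G).  H = G is (G , ⊤), and G' = G - S is (G , ∁ S).

anyFin : ∀ {n} → (Fin n → Bool) → Bool
anyFin {zero}  f = false
anyFin {suc n} f = f Data.Fin.zero ∨ anyFin (λ i → f (Data.Fin.suc i))

allFin : ∀ {n} → (Fin n → Bool) → Bool
allFin {zero}  f = true
allFin {suc n} f = f Data.Fin.zero ∧ allFin (λ i → f (Data.Fin.suc i))

ΣFin : ∀ {n} → (Fin n → ℚ) → ℚ
ΣFin {zero}  f = 0ℚ
ΣFin {suc n} f = f Data.Fin.zero + ΣFin (λ i → f (Data.Fin.suc i))

Σ∈ : ∀ {n} → Subset n → (Fin n → ℚ) → ℚ
Σ∈ I f = ΣFin (λ v → if lookup I v then f v else 0ℚ)

allSubsets : ∀ n → List (Subset n)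
allSubsets zero    = [] ∷ []
allSubsets (suc n) = map (outside ∷_) (allSubsets n) ++ map (inside ∷_) (allSubsets n)

ΣSub : ∀ {n} → (Subset n → ℚ) → ℚ
ΣSub {n} f = foldr (λ I acc → f I + acc) 0ℚ (allSubsets n)

ℕ→ℚ : ℕ → ℚ
ℕ→ℚ k = ℤ.+ k ℚ./ 1

-- q / d, with the convention q / 0 = 0 (only used when d = 0 forces q = 0
-- or is irrelevant)
divℕ : ℚ → ℕ → ℚ
divℕ q zero    = 0ℚ
divℕ q (suc d) = q * (ℤ.+ 1 ℚ./ suc d)

isIndep : ∀ {n} → SimpleGraph n → Subset n → Subset n → Bool
isIndep G W I =
  allFin (λ v → not (lookup I v) ∨ lookup W v) ∧
  allFin (λ u → allFin (λ v → not (lookup I u ∧ lookup I v ∧ adj G u v)))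

Independent : ∀ {n} → SimpleGraph n → Subset n → Subset n → Set
Independent G W I = T (isIndep G W I)

openN : ∀ {n} → SimpleGraph n → Subset n → Subset n → Subset n
openN G W I = tabulate (λ v → lookup W v ∧ anyFin (λ u → lookup I u ∧ adj G u v))

closedN : ∀ {n} → SimpleGraph n → Subset n → Subset n → Subset n
closedN G W I = tabulate (λ v → lookup W v ∧ (lookup I v ∨ lookup (openN G W I) v))

aH : ∀ {n} → SimpleGraph n → Subset n → Subset n → ℕ
aH G W I = ∣ W ─ closedN G W I ∣

bAux : ∀ {n} → SimpleGraph n → Subset n → ℕ → Subset n → ℚ
bAux G W zero    I = 1ℚ
bAux G W (suc k) I = divℕ (Σ∈ I (λ v → bAux G W k (I ─ ⁅ v ⁆))) ∣ closedN G W I ∣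

bH : ∀ {n} → SimpleGraph n → Subset n → Subset n → ℚ
bH G W I = bAux G W ∣ I ∣ I

wH : ∀ {n} → SimpleGraph n → Subset n → Subset n → ℚ
wH G W I = divℕ (ℕ→ℚ (aH G W I)) ∣ W ∣ * bH G W I

-- Polynomials of the form Σ_{I : p I} f(I) x^{|I|}, given by their
-- coefficient sequence: coefficient of x^k.

coeff : ∀ {n} → (Subset n → Bool) → (Subset n → ℚ) → ℕ → ℚ
coeff p f k = ΣSub (λ I → if p I ∧ (∣ I ∣ ℕ.≡ᵇ k) then f I else 0ℚ)

meets : ∀ {n} → Subset n → Subset n → Bool
meets I S = anyFin (λ v → lookup I v ∧ lookup S v)

P : ∀ {n} → SimpleGraph n → Subset n → ℕ → ℚ
P G W = coeff (isIndep G W) (wH G W)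

U : ∀ {n} → SimpleGraph n → Subset n → ℕ → ℚ
U G S = coeff (λ I → isIndep G ⊤ I ∧ meets I S) (wH G ⊤)

R : ∀ {n} → SimpleGraph n → Subset n → ℕ → ℚ
R G S = coeff (isIndep G (Data.Fin.Subset.∁ S)) (λ I → wH G (Data.Fin.Subset.∁ S) I - wH G ⊤ I)

Δb : ∀ {n} → SimpleGraph n → Subset n → Subset n → ℚ
Δb G S I = bH G (Data.Fin.Subset.∁ S) I - bH G ⊤ I

{-# OPTIONS --safe #-}

-- An independent set of G - S is exactly an independent set of G avoiding S, and for it
-- N_{G-S}[I] = N_G[I] - S.  Splitting the sum defining P_G according to whether I meets S
-- gives P_G = P_{G-S} - R_S + U_S.  Subtracting the defining recursions of b_{G-S} and b_G,
-- and using |N_G[I]| = |N_{G-S}[I]| + |N_G[I] ∩ S|, yields the recursion for Δb; its leading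
-- coefficient |N_{G-S}[I]| is positive for nonempty I, so by induction on |I| the recursion
-- has at most one solution with a given value at ∅.

module Submission where

open import Defs hiding (sym)
open import Algebra.Bundles using (CommutativeMonoid)
import Algebra.Properties.CommutativeSemigroup as CommutativeSemigroupProperties
open import Data.Bool using (Bool; true; false; _∧_; _∨_; not; if_then_else_; T)
open import Data.Bool.Properties using (T-≡; T-∧; T-∨; ∧-zeroʳ; ∧-identityʳ; ∧-comm)
open import Data.Empty using (⊥-elim)
open import Data.Fin using (Fin)
open import Data.Fin.Subset
  using (Subset; ∣_∣; _─_; ⁅_⁆; _∩_; ⊤; ⊥; ∁; Nonempty; Empty; _∈_; _⊆_; inside; outside)
open import Data.Fin.Subset.Properties
  using (∈⊤; ∣⊥∣≡0; ∣⁅x⁆∣≡1; x∈⁅y⁆⇒x≡y; x∈p∩q⁺; x∈p∩q⁻; p∩q⊆q; ⊆-antisym; ∩-comm; p─q⊆p;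
         x∈∁p⇒x∉p; x∉p⇒x∈∁p; x∈p⇒∣p-x∣<∣p∣; Empty-unique; nonempty?)
open import Data.Integer as ℤ using (+_)
import Data.Integer.Properties as ℤ
import Data.Integer.Solver as ℤ-Solver
open import Data.List using (List; []; _∷_; foldr)
open import Data.Nat as ℕ using (ℕ; zero; suc)
open import Data.Nat.Induction using (<-wellFounded)
import Data.Nat.Properties as ℕ
open import Data.Product using (_×_; _,_; ∃; proj₁; proj₂)
open import Data.Rational as ℚ using (ℚ; 0ℚ; 1ℚ; _+_; _*_; _-_; toℚᵘ)
open import Data.Rational.Properties
  using (toℚᵘ-injective; toℚᵘ-fromℚᵘ; toℚᵘ-homo-+; toℚᵘ-homo-*;
         +-inverseʳ; *-identityʳ; *-assoc; +-0-commutativeMonoid)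
import Data.Rational.Solver as ℚ-Solver
import Data.Rational.Unnormalised as ℚᵘ
import Data.Rational.Unnormalised.Properties as ℚᵘ
open import Data.Sum using (inj₁; inj₂)
open import Data.Vec using ([]; _∷_; lookup)
open import Data.Vec.Properties
  using (lookup-replicate; lookup-map; lookup-zipWith; lookup∘tabulate;
         tabulate∘lookup; tabulate-cong; []=⇒lookup; lookup⇒[]=)
open import Function using (_∘_; _on_; _⇔_; mk⇔; Equivalence)
open import Induction.WellFounded using (Acc; acc)
open import Relation.Binary.Construct.On using (wellFounded)
open import Relation.Binary.PropositionalEquality
open import Relation.Nullary using (¬_; yes; no)

open Equivalence using (to; from)

private
  variable
    n : ℕ

T-not : ∀ b → T (not b) ⇔ (¬ T b)
T-not true  = mk⇔ (λ ()) (λ ¬t → ¬t _)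
T-not false = mk⇔ (λ _ ()) (λ _ → _)

T-not-∨ : ∀ a b → T (not a ∨ b) ⇔ (T a → T b)
T-not-∨ true  b = mk⇔ (λ t _ → t) (λ h → h _)
T-not-∨ false b = mk⇔ (λ _ ()) (λ _ → _)

T-not-∧ : ∀ a b → T (not (a ∧ b)) ⇔ (T a → T (not b))
T-not-∧ true  b = mk⇔ (λ t _ → t) (λ h → h _)
T-not-∧ false b = mk⇔ (λ _ ()) (λ _ → _)

T-injective : ∀ {a b} → T a ⇔ T b → a ≡ b
T-injective {true}  {true}  _ = refl
T-injective {true}  {false} e = ⊥-elim (to e _)
T-injective {false} {true}  e = ⊥-elim (from e _)
T-injective {false} {false} _ = refl

T-allFin : ∀ (f : Fin n → Bool) → T (allFin f) ⇔ (∀ i → T (f i))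
T-allFin {zero}  f = mk⇔ (λ _ ()) (λ _ → _)
T-allFin {suc n} f =
  mk⇔ split (λ h → from T-∧ (h Fin.zero , from (T-allFin (f ∘ Fin.suc)) (h ∘ Fin.suc)))
  where
  split : T (allFin f) → ∀ i → T (f i)
  split t Fin.zero    = proj₁ (to T-∧ t)
  split t (Fin.suc i) = to (T-allFin (f ∘ Fin.suc)) (proj₂ (to T-∧ t)) i

T-anyFin : ∀ (f : Fin n → Bool) → T (anyFin f) ⇔ ∃ (λ i → T (f i))
T-anyFin {zero}  f = mk⇔ (λ ()) (λ ())
T-anyFin {suc n} f = mk⇔ witness choose
  where
  witness : T (anyFin f) → ∃ (λ i → T (f i))
  witness t with to T-∨ t
  ... | inj₁ t₀ = Fin.zero , t₀
  ... | inj₂ ts = let i , tᵢ = to (T-anyFin (f ∘ Fin.suc)) ts in Fin.suc i , tᵢ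
  choose : ∃ (λ i → T (f i)) → T (anyFin f)
  choose (Fin.zero  , t) = from T-∨ (inj₁ t)
  choose (Fin.suc i , t) = from T-∨ (inj₂ (from (T-anyFin (f ∘ Fin.suc)) (i , t)))

∈⇔T-lookup : ∀ {p : Subset n} {x} → x ∈ p ⇔ T (lookup p x)
∈⇔T-lookup {p = p} {x} = mk⇔ (from T-≡ ∘ []=⇒lookup) (lookup⇒[]= x p ∘ to T-≡)

lookup-⊤ : ∀ (v : Fin n) → lookup ⊤ v ≡ true
lookup-⊤ v = lookup-replicate v true

lookup-∁ : ∀ (p : Subset n) v → lookup (∁ p) v ≡ not (lookup p v)
lookup-∁ p v = lookup-map v not p

lookup-∩ : ∀ (p q : Subset n) v → lookup (p ∩ q) v ≡ lookup p v ∧ lookup q v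
lookup-∩ p q v = lookup-zipWith _∧_ v p q

lookup-─ : ∀ (p q : Subset n) v → lookup (p ─ q) v ≡ lookup p v ∧ not (lookup q v)
lookup-─ (x ∷ p) (inside  ∷ q) Fin.zero    = sym (∧-zeroʳ x)
lookup-─ (x ∷ p) (outside ∷ q) Fin.zero    = sym (∧-identityʳ x)
lookup-─ (x ∷ p) (y       ∷ q) (Fin.suc v) = lookup-─ p q v

lookup-ext : ∀ {p q : Subset n} → (∀ v → lookup p v ≡ lookup q v) → p ≡ q
lookup-ext {p = p} {q} h =
  trans (sym (tabulate∘lookup p)) (trans (tabulate-cong h) (tabulate∘lookup q))

p⊆∁q⇔Empty[p∩q] : ∀ {p q : Subset n} → p ⊆ ∁ q ⇔ Empty (p ∩ q)
p⊆∁q⇔Empty[p∩q] {p = p} {q} = mk⇔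
  (λ p⊆∁q (x , x∈p∩q) → let x∈p , x∈q = x∈p∩q⁻ p q x∈p∩q in x∈∁p⇒x∉p (p⊆∁q x∈p) x∈q)
  (λ empty {x} x∈p → x∉p⇒x∈∁p (λ x∈q → empty (_ , x∈p∩q⁺ (x∈p , x∈q))))

T-meets : ∀ (I S : Subset n) → T (meets I S) ⇔ Nonempty (I ∩ S)
T-meets I S = mk⇔
  (λ t → let v , tv = to (T-anyFin _) t ; tI , tS = to (T-∧ {lookup I v}) tv
         in v , x∈p∩q⁺ (from ∈⇔T-lookup tI , from ∈⇔T-lookup tS))
  (λ (v , v∈I∩S) → let v∈I , v∈S = x∈p∩q⁻ I S v∈I∩S
         in from (T-anyFin _) (v , from T-∧ (to ∈⇔T-lookup v∈I , to ∈⇔T-lookup v∈S)))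

∣p∣≡∣p∩q∣+∣p─q∣ : ∀ (p q : Subset n) → ∣ p ∣ ≡ ∣ p ∩ q ∣ ℕ.+ ∣ p ─ q ∣
∣p∣≡∣p∩q∣+∣p─q∣ []            []            = refl
∣p∣≡∣p∩q∣+∣p─q∣ (inside  ∷ p) (inside  ∷ q) = cong suc (∣p∣≡∣p∩q∣+∣p─q∣ p q)
∣p∣≡∣p∩q∣+∣p─q∣ (inside  ∷ p) (outside ∷ q) =
  trans (cong suc (∣p∣≡∣p∩q∣+∣p─q∣ p q)) (sym (ℕ.+-suc _ _))
∣p∣≡∣p∩q∣+∣p─q∣ (outside ∷ p) (inside  ∷ q) = ∣p∣≡∣p∩q∣+∣p─q∣ p q
∣p∣≡∣p∩q∣+∣p─q∣ (outside ∷ p) (outside ∷ q) = ∣p∣≡∣p∩q∣+∣p─q∣ p q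

x∈p⇒∣p∣≡1+∣p-x∣ : ∀ {p : Subset n} {x} → x ∈ p → ∣ p ∣ ≡ suc ∣ p ─ ⁅ x ⁆ ∣
x∈p⇒∣p∣≡1+∣p-x∣ {p = p} {x} x∈p = begin
  ∣ p ∣                                ≡⟨ ∣p∣≡∣p∩q∣+∣p─q∣ p ⁅ x ⁆ ⟩
  ∣ p ∩ ⁅ x ⁆ ∣ ℕ.+ ∣ p ─ ⁅ x ⁆ ∣      ≡⟨ cong (λ r → ∣ r ∣ ℕ.+ ∣ p ─ ⁅ x ⁆ ∣) p∩⁅x⁆≡⁅x⁆ ⟩
  ∣ ⁅ x ⁆ ∣ ℕ.+ ∣ p ─ ⁅ x ⁆ ∣          ≡⟨ cong (ℕ._+ ∣ p ─ ⁅ x ⁆ ∣) (∣⁅x⁆∣≡1 x) ⟩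
  suc ∣ p ─ ⁅ x ⁆ ∣                    ∎
  where
  open ≡-Reasoning
  p∩⁅x⁆≡⁅x⁆ : p ∩ ⁅ x ⁆ ≡ ⁅ x ⁆
  p∩⁅x⁆≡⁅x⁆ = ⊆-antisym (p∩q⊆q p ⁅ x ⁆)
    (λ y∈⁅x⁆ → x∈p∩q⁺ (subst (_∈ p) (sym (x∈⁅y⁆⇒x≡y x y∈⁅x⁆)) x∈p , y∈⁅x⁆))

x∈p⇒∣p∣≢0 : ∀ {p : Subset n} {x} → x ∈ p → ∣ p ∣ ≢ 0
x∈p⇒∣p∣≢0 = ℕ.m<n⇒n≢0 ∘ x∈p⇒∣p-x∣<∣p∣

+[m+n]-+m≡+n : ∀ m n → + (m ℕ.+ n) ℤ.- + m ≡ + n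
+[m+n]-+m≡+n m n = trans (cong (ℤ._- + m) (ℤ.pos-+ m n))
  (solve 2 (λ m n → (m :+ n) :- m := n) refl (+ m) (+ n))
  where open ℤ-Solver.+-*-Solver

-- ℕ→ℚ k = + k / 1 is stuck on a gcd for variable k; in ℚᵘ it is plainly k/1.
toℚᵘ-ℕ→ℚ : ∀ k → toℚᵘ (ℕ→ℚ k) ℚᵘ.≃ ℚᵘ.mkℚᵘ (+ k) 0
toℚᵘ-ℕ→ℚ k = toℚᵘ-fromℚᵘ (ℚᵘ.mkℚᵘ (+ k) 0)

ℕ→ℚ-+ : ∀ a b → ℕ→ℚ (a ℕ.+ b) ≡ ℕ→ℚ a + ℕ→ℚ b
ℕ→ℚ-+ a b = toℚᵘ-injective (begin
  toℚᵘ (ℕ→ℚ (a ℕ.+ b))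
    ≈⟨ toℚᵘ-ℕ→ℚ (a ℕ.+ b) ⟩
  ℚᵘ.mkℚᵘ (+ (a ℕ.+ b)) 0
    ≈⟨ ℚᵘ.*≡* (trans (cong (ℤ._* (+ 1 ℤ.* + 1)) (ℤ.pos-+ a b)) cross) ⟩
  ℚᵘ.mkℚᵘ (+ a) 0 ℚᵘ.+ ℚᵘ.mkℚᵘ (+ b) 0
    ≈⟨ ℚᵘ.+-cong (ℚᵘ.≃-sym (toℚᵘ-ℕ→ℚ a)) (ℚᵘ.≃-sym (toℚᵘ-ℕ→ℚ b)) ⟩
  toℚᵘ (ℕ→ℚ a) ℚᵘ.+ toℚᵘ (ℕ→ℚ b)
    ≈⟨ ℚᵘ.≃-sym (toℚᵘ-homo-+ (ℕ→ℚ a) (ℕ→ℚ b)) ⟩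
  toℚᵘ (ℕ→ℚ a + ℕ→ℚ b) ∎)
  where
  open ℚᵘ.≃-Reasoning
  open ℤ-Solver.+-*-Solver
  cross : (+ a ℤ.+ + b) ℤ.* (+ 1 ℤ.* + 1) ≡ (+ a ℤ.* + 1 ℤ.+ + b ℤ.* + 1) ℤ.* + 1
  cross = solve 2 (λ x y → (x :+ y) :* (con (+ 1) :* con (+ 1))
                         := (x :* con (+ 1) :+ y :* con (+ 1)) :* con (+ 1))
                refl (+ a) (+ b)

ℕ→ℚ-*-1/ : ∀ d → ℕ→ℚ (suc d) * (+ 1 ℚ./ suc d) ≡ 1ℚ
ℕ→ℚ-*-1/ d = toℚᵘ-injective (begin
  toℚᵘ (ℕ→ℚ (suc d) * (+ 1 ℚ./ suc d))
    ≈⟨ toℚᵘ-homo-* (ℕ→ℚ (suc d)) (+ 1 ℚ./ suc d) ⟩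
  toℚᵘ (ℕ→ℚ (suc d)) ℚᵘ.* toℚᵘ (+ 1 ℚ./ suc d)
    ≈⟨ ℚᵘ.*-cong (toℚᵘ-ℕ→ℚ (suc d)) (toℚᵘ-fromℚᵘ (ℚᵘ.mkℚᵘ (+ 1) d)) ⟩
  ℚᵘ.mkℚᵘ (+ suc d) 0 ℚᵘ.* ℚᵘ.mkℚᵘ (+ 1) d
    ≈⟨ ℚᵘ.*≡* cross ⟩
  ℚᵘ.1ℚᵘ ∎)
  where
  open ℚᵘ.≃-Reasoning
  open ℤ-Solver.+-*-Solver
  cross : (+ suc d ℤ.* + 1) ℤ.* + 1 ≡ + 1 ℤ.* (+ 1 ℤ.* + suc d)
  cross = solve 1 (λ x → (x :* con (+ 1)) :* con (+ 1) := con (+ 1) :* (con (+ 1) :* x))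
                refl (+ suc d)

ℕ→ℚ-*-divℕ : ∀ {k} q → k ≢ 0 → ℕ→ℚ k * divℕ q k ≡ q
ℕ→ℚ-*-divℕ {zero}  q k≢0 = ⊥-elim (k≢0 refl)
ℕ→ℚ-*-divℕ {suc d} q _   = begin
  c * (q * r)  ≡⟨ solve 3 (λ c q r → c :* (q :* r) := q :* (c :* r)) refl c q r ⟩
  q * (c * r)  ≡⟨ cong (q *_) (ℕ→ℚ-*-1/ d) ⟩
  q * 1ℚ       ≡⟨ *-identityʳ q ⟩
  q            ∎
  where
  open ≡-Reasoning
  open ℚ-Solver.+-*-Solver
  c r : ℚ
  c = ℕ→ℚ (suc d)
  r = + 1 ℚ./ suc d

ℕ→ℚ-*-cancelˡ : ∀ {k} {p q} → k ≢ 0 → ℕ→ℚ k * p ≡ ℕ→ℚ k * q → p ≡ q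
ℕ→ℚ-*-cancelˡ {k} {p} {q} k≢0 kp≡kq = begin
  p                    ≡⟨ sym (divℕ-ℕ→ℚ-* p k≢0) ⟩
  divℕ (ℕ→ℚ k * p) k  ≡⟨ cong (λ x → divℕ x k) kp≡kq ⟩
  divℕ (ℕ→ℚ k * q) k  ≡⟨ divℕ-ℕ→ℚ-* q k≢0 ⟩
  q                    ∎
  where
  open ≡-Reasoning
  divℕ-ℕ→ℚ-* : ∀ {k} x → k ≢ 0 → divℕ (ℕ→ℚ k * x) k ≡ x
  divℕ-ℕ→ℚ-* {zero}  x k≢0 = ⊥-elim (k≢0 refl)
  divℕ-ℕ→ℚ-* {suc d} x k≢0 = trans (*-assoc (ℕ→ℚ (suc d)) x _) (ℕ→ℚ-*-divℕ x k≢0)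

[a-b]+[c-d]≡[a+c]-[b+d] : ∀ a b c d → (a - b) + (c - d) ≡ (a + c) - (b + d)
[a-b]+[c-d]≡[a+c]-[b+d] = solve 4 (λ a b c d → (a :- b) :+ (c :- d) := (a :+ c) :- (b :+ d)) refl
  where open ℚ-Solver.+-*-Solver

-- ΣSub is ΣList (allSubsets n), and the summands of coeff and Σ∈ are of the form x when b,
-- all definitionally.
infix 5 _when_

_when_ : ℚ → Bool → ℚ
x when b = if b then x else 0ℚ

ΣList : ∀ {A : Set} → List A → (A → ℚ) → ℚ
ΣList xs f = foldr (λ x acc → f x + acc) 0ℚ xs

ΣList-cong : ∀ {A : Set} (xs : List A) {f g : A → ℚ} → (∀ x → f x ≡ g x) → ΣList xs f ≡ ΣList xs g
ΣList-cong []       h = refl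
ΣList-cong (x ∷ xs) h = cong₂ _+_ (h x) (ΣList-cong xs h)

ΣList-+ : ∀ {A : Set} (xs : List A) (f g : A → ℚ) →
          ΣList xs (λ x → f x + g x) ≡ ΣList xs f + ΣList xs g
ΣList-+ []       f g = refl
ΣList-+ (x ∷ xs) f g = trans (cong (_+_ (f x + g x)) (ΣList-+ xs f g))
  (+-interchange (f x) (g x) (ΣList xs f) (ΣList xs g))
  where
  open CommutativeSemigroupProperties (CommutativeMonoid.commutativeSemigroup +-0-commutativeMonoid)
    using () renaming (interchange to +-interchange)

ΣList-- : ∀ {A : Set} (xs : List A) (f g : A → ℚ) →
          ΣList xs (λ x → f x - g x) ≡ ΣList xs f - ΣList xs g
ΣList-- []       f g = refl
ΣList-- (x ∷ xs) f g = trans (cong (_+_ (f x - g x)) (ΣList-- xs f g))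
  ([a-b]+[c-d]≡[a+c]-[b+d] (f x) (g x) (ΣList xs f) (ΣList xs g))

ΣFin-cong : ∀ {f g : Fin n → ℚ} → (∀ i → f i ≡ g i) → ΣFin f ≡ ΣFin g
ΣFin-cong {zero}  h = refl
ΣFin-cong {suc n} h = cong₂ _+_ (h Fin.zero) (ΣFin-cong (h ∘ Fin.suc))

ΣFin-- : ∀ (f g : Fin n → ℚ) → ΣFin (λ i → f i - g i) ≡ ΣFin f - ΣFin g
ΣFin-- {zero}  f g = refl
ΣFin-- {suc n} f g =
  trans (cong (_+_ (f Fin.zero - g Fin.zero)) (ΣFin-- (f ∘ Fin.suc) (g ∘ Fin.suc)))
        ([a-b]+[c-d]≡[a+c]-[b+d] (f Fin.zero) (g Fin.zero) (ΣFin (f ∘ Fin.suc)) (ΣFin (g ∘ Fin.suc)))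

Σ∈-cong : ∀ (I : Subset n) {f g : Fin n → ℚ} → (∀ {v} → v ∈ I → f v ≡ g v) → Σ∈ I f ≡ Σ∈ I g
Σ∈-cong I {f} {g} h = ΣFin-cong termwise
  where
  termwise : ∀ v → (f v when lookup I v) ≡ (g v when lookup I v)
  termwise v with lookup I v in v∈I
  ... | true  = h (lookup⇒[]= v I v∈I)
  ... | false = refl

Σ∈-- : ∀ (I : Subset n) (f g : Fin n → ℚ) → Σ∈ I (λ v → f v - g v) ≡ Σ∈ I f - Σ∈ I g
Σ∈-- I f g =
  trans (ΣFin-cong termwise) (ΣFin-- (λ v → f v when lookup I v) (λ v → g v when lookup I v))
  where
  termwise : ∀ v → (f v - g v) when lookup I v ≡ (f v when lookup I v) - (g v when lookup I v)
  termwise v with lookup I v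
  ... | true  = refl
  ... | false = refl

-- With a = [I ∈ 𝓘(G)], m = [I ∩ S ≠ ∅] and e = [|I| = k], this is the I-th summand of the
-- coefficient identity P_G = P_{G-S} - R_S + U_S, once a ∧ not m is recognised as [I ∈ 𝓘(G-S)].
when-split : ∀ a m e (x y : ℚ) →
  x when a ∧ e ≡ ((y when (a ∧ not m) ∧ e) - ((y - x) when (a ∧ not m) ∧ e)) + (x when (a ∧ m) ∧ e)
when-split false m     e     x y = refl
when-split true  true  false x y = refl
when-split true  false false x y = refl
when-split true  true  true  x y = solve 1 (λ x → x := (con 0ℚ :- con 0ℚ) :+ x) refl x
  where open ℚ-Solver.+-*-Solver
when-split true  false true  x y = solve 2 (λ x y → x := (y :- (y :- x)) :+ con 0ℚ) refl x y
  where open ℚ-Solver.+-*-Solver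

-- Independent sets and closed neighbourhoods

module _ (G : SimpleGraph n) where

  lookup-closedN : ∀ W I v → lookup (closedN G W I) v
                   ≡ lookup W v ∧ (lookup I v ∨ lookup W v ∧ anyFin (λ u → lookup I u ∧ adj G u v))
  lookup-closedN W I v = trans (lookup∘tabulate _ v)
    (cong (λ b → lookup W v ∧ (lookup I v ∨ b)) (lookup∘tabulate _ v))

  I⊆closedN : ∀ {W I} → I ⊆ W → I ⊆ closedN G W I
  I⊆closedN {W} {I} I⊆W {v} v∈I = lookup⇒[]= v (closedN G W I) (begin
    lookup (closedN G W I) v
      ≡⟨ lookup-closedN W I v ⟩
    lookup W v ∧ (lookup I v ∨ lookup W v ∧ anyFin (λ u → lookup I u ∧ adj G u v))
      ≡⟨ cong₂ (λ w i → w ∧ (i ∨ w ∧ anyFin (λ u → lookup I u ∧ adj G u v)))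
               ([]=⇒lookup (I⊆W v∈I)) ([]=⇒lookup v∈I) ⟩
    true ∎)
    where open ≡-Reasoning

  record IsIndependent (W I : Subset n) : Set where
    field
      ⊆W          : I ⊆ W
      nonadjacent : ∀ {u v} → u ∈ I → v ∈ I → T (not (adj G u v))
  open IsIndependent

  Independent⇔IsIndependent : ∀ {W I} → Independent G W I ⇔ IsIndependent W I
  Independent⇔IsIndependent {W} {I} = mk⇔ decode encode
    where
    within : Fin n → Bool
    within v = not (lookup I v) ∨ lookup W v
    apart : Fin n → Fin n → Bool
    apart u v = not (lookup I u ∧ lookup I v ∧ adj G u v)

    decode : Independent G W I → IsIndependent W I
    decode ind with to (T-∧ {allFin within} {allFin (allFin ∘ apart)}) ind
    ... | all-within , all-apart = record
      { ⊆W          = λ {v} v∈I → from ∈⇔T-lookup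
          (to (T-not-∨ (lookup I v) (lookup W v)) (to (T-allFin within) all-within v)
              (to ∈⇔T-lookup v∈I))
      ; nonadjacent = λ {u} {v} u∈I v∈I →
          to (T-not-∧ (lookup I v) (adj G u v))
             (to (T-not-∧ (lookup I u) (lookup I v ∧ adj G u v))
                 (to (T-allFin (apart u)) (to (T-allFin (allFin ∘ apart)) all-apart u) v)
                 (to ∈⇔T-lookup u∈I))
             (to ∈⇔T-lookup v∈I)
      }

    encode : IsIndependent W I → Independent G W I
    encode ind = from (T-∧ {allFin within} {allFin (allFin ∘ apart)})
      ( from (T-allFin within) (λ v → from (T-not-∨ (lookup I v) (lookup W v))
          (λ tv → to ∈⇔T-lookup (⊆W ind (from ∈⇔T-lookup tv))))
      , from (T-allFin (allFin ∘ apart)) (λ u → from (T-allFin (apart u)) (λ v →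
          from (T-not-∧ (lookup I u) (lookup I v ∧ adj G u v)) (λ tu →
            from (T-not-∧ (lookup I v) (adj G u v)) (λ tv →
              nonadjacent ind (from ∈⇔T-lookup tu) (from ∈⇔T-lookup tv))))) )

  Independent-⊆ : ∀ {W I J} → J ⊆ I → Independent G W I → Independent G W J
  Independent-⊆ {W} {I} {J} J⊆I ind = from (Independent⇔IsIndependent {W} {J}) (record
    { ⊆W          = λ v∈J → ⊆W I-ind (J⊆I v∈J)
    ; nonadjacent = λ u∈J v∈J → nonadjacent I-ind (J⊆I u∈J) (J⊆I v∈J)
    })
    where
    I-ind : IsIndependent W I
    I-ind = to Independent⇔IsIndependent ind

  Independent⇒⊆ : ∀ {W I} → Independent G W I → I ⊆ W
  Independent⇒⊆ {W} {I} = ⊆W ∘ to (Independent⇔IsIndependent {W} {I})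

  bH-⊥ : ∀ W → bH G W ⊥ ≡ 1ℚ
  bH-⊥ W = cong (λ k → bAux G W k ⊥) (∣⊥∣≡0 n)

  bH-rec : ∀ {W I} → I ⊆ W → Nonempty I →
           ℕ→ℚ ∣ closedN G W I ∣ * bH G W I ≡ Σ∈ I (λ v → bH G W (I ─ ⁅ v ⁆))
  bH-rec {W} {I} I⊆W (v , v∈I) = begin
    ℕ→ℚ ∣ closedN G W I ∣ * bAux G W (∣ I ∣) I
      ≡⟨ cong (λ k → ℕ→ℚ ∣ closedN G W I ∣ * bAux G W k I) (x∈p⇒∣p∣≡1+∣p-x∣ v∈I) ⟩
    ℕ→ℚ ∣ closedN G W I ∣
      * divℕ (Σ∈ I (λ u → bAux G W (∣ I ─ ⁅ v ⁆ ∣) (I ─ ⁅ u ⁆))) (∣ closedN G W I ∣)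
      ≡⟨ ℕ→ℚ-*-divℕ _ (x∈p⇒∣p∣≢0 (I⊆closedN I⊆W v∈I)) ⟩
    Σ∈ I (λ u → bAux G W (∣ I ─ ⁅ v ⁆ ∣) (I ─ ⁅ u ⁆))
      ≡⟨ Σ∈-cong I (λ u∈I → cong (λ k → bAux G W k _) (same-size u∈I)) ⟩
    Σ∈ I (λ u → bH G W (I ─ ⁅ u ⁆))  ∎
    where
    open ≡-Reasoning
    same-size : ∀ {u} → u ∈ I → ∣ I ─ ⁅ v ⁆ ∣ ≡ ∣ I ─ ⁅ u ⁆ ∣
    same-size u∈I = ℕ.suc-injective (trans (sym (x∈p⇒∣p∣≡1+∣p-x∣ v∈I)) (x∈p⇒∣p∣≡1+∣p-x∣ u∈I))

  SolvesRecursion : Subset n → (Subset n → ℚ) → (Subset n → ℚ) → Set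
  SolvesRecursion W g f = ∀ I → Independent G W I → Nonempty I →
    ℕ→ℚ ∣ closedN G W I ∣ * f I ≡ Σ∈ I (λ v → f (I ─ ⁅ v ⁆)) + g I

  recursion-unique : ∀ {W g f h} → SolvesRecursion W g f → SolvesRecursion W g h → f ⊥ ≡ h ⊥ →
                     ∀ I → Independent G W I → f I ≡ h I
  recursion-unique {W} {g} {f} {h} f-solves h-solves f⊥≡h⊥ I =
    go I (wellFounded ∣_∣ <-wellFounded I)
    where
    go : ∀ I → Acc (ℕ._<_ on ∣_∣) I → Independent G W I → f I ≡ h I
    go I (acc smaller) ind with nonempty? I
    ... | no  empty = subst (λ J → f J ≡ h J) (sym (Empty-unique empty)) f⊥≡h⊥
    ... | yes ne@(v , v∈I) =
      ℕ→ℚ-*-cancelˡ (x∈p⇒∣p∣≢0 (I⊆closedN (Independent⇒⊆ {W} ind) v∈I)) (begin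
      ℕ→ℚ ∣ closedN G W I ∣ * f I         ≡⟨ f-solves I ind ne ⟩
      Σ∈ I (λ u → f (I ─ ⁅ u ⁆)) + g I    ≡⟨ cong (_+ g I) (Σ∈-cong I hypothesis) ⟩
      Σ∈ I (λ u → h (I ─ ⁅ u ⁆)) + g I    ≡⟨ sym (h-solves I ind ne) ⟩
      ℕ→ℚ ∣ closedN G W I ∣ * h I         ∎)
      where
      open ≡-Reasoning
      hypothesis : ∀ {u} → u ∈ I → f (I ─ ⁅ u ⁆) ≡ h (I ─ ⁅ u ⁆)
      hypothesis {u} u∈I =
        go (I ─ ⁅ u ⁆) (smaller (x∈p⇒∣p-x∣<∣p∣ u∈I)) (Independent-⊆ {W} {I} (p─q⊆p I ⁅ u ⁆) ind)

-- Deleting a vertex set S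

module _ (G : SimpleGraph n) (S : Subset n) where
  open IsIndependent

  Independent-∁⇔ : ∀ {I} → Independent G (∁ S) I ⇔ (Independent G ⊤ I × Empty (I ∩ S))
  Independent-∁⇔ {I} = mk⇔ forget remember
    where
    forget : Independent G (∁ S) I → Independent G ⊤ I × Empty (I ∩ S)
    forget ind =
        from (Independent⇔IsIndependent G {⊤} {I})
             (record { ⊆W = λ _ → ∈⊤ ; nonadjacent = nonadjacent r })
      , to p⊆∁q⇔Empty[p∩q] (⊆W r)
      where
      r : IsIndependent G (∁ S) I
      r = to (Independent⇔IsIndependent G) ind
    remember : Independent G ⊤ I × Empty (I ∩ S) → Independent G (∁ S) I
    remember (ind , empty) = from (Independent⇔IsIndependent G {∁ S} {I}) (record
      { ⊆W          = from p⊆∁q⇔Empty[p∩q] empty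
      ; nonadjacent = nonadjacent (to (Independent⇔IsIndependent G {⊤}) ind)
      })

  isIndep-∁ : ∀ I → isIndep G (∁ S) I ≡ isIndep G ⊤ I ∧ not (meets I S)
  isIndep-∁ I = T-injective (mk⇔
    (λ ind → let ind⊤ , empty = to Independent-∁⇔ ind
             in from T-∧ (ind⊤ , from (T-not (meets I S)) (empty ∘ to (T-meets I S))))
    (λ t → let ind⊤ , disjoint = to (T-∧ {isIndep G ⊤ I}) t
           in from Independent-∁⇔ (ind⊤ , to (T-not (meets I S)) disjoint ∘ from (T-meets I S))))

  closedN-∁ : ∀ I → closedN G (∁ S) I ≡ closedN G ⊤ I ─ S
  closedN-∁ I = lookup-ext λ v → begin
    lookup (closedN G (∁ S) I) v
      ≡⟨ lookup-closedN G (∁ S) I v ⟩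
    lookup (∁ S) v ∧ (lookup I v ∨ lookup (∁ S) v ∧ N v)
      ≡⟨ cong (λ s → s ∧ (lookup I v ∨ s ∧ N v)) (lookup-∁ S v) ⟩
    not (lookup S v) ∧ (lookup I v ∨ not (lookup S v) ∧ N v)
      ≡⟨ drop-S (lookup S v) (lookup I v) (N v) ⟩
    (lookup I v ∨ N v) ∧ not (lookup S v)
      ≡⟨ cong (_∧ not (lookup S v)) (sym (lookup-closedN-⊤ v)) ⟩
    lookup (closedN G ⊤ I) v ∧ not (lookup S v)
      ≡⟨ sym (lookup-─ (closedN G ⊤ I) S v) ⟩
    lookup (closedN G ⊤ I ─ S) v ∎
    where
    open ≡-Reasoning
    N : Fin n → Bool
    N v = anyFin (λ u → lookup I u ∧ adj G u v)
    drop-S : ∀ s i a → not s ∧ (i ∨ not s ∧ a) ≡ (i ∨ a) ∧ not s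
    drop-S true  i a = sym (∧-zeroʳ (i ∨ a))
    drop-S false i a = sym (∧-identityʳ (i ∨ a))
    lookup-closedN-⊤ : ∀ v → lookup (closedN G ⊤ I) v ≡ lookup I v ∨ N v
    lookup-closedN-⊤ v =
      trans (lookup-closedN G ⊤ I v) (cong (λ t → t ∧ (lookup I v ∨ t ∧ N v)) (lookup-⊤ v))

  ∣closedN∣-split : ∀ I → ∣ closedN G ⊤ I ∣ ≡ ∣ closedN G ⊤ I ∩ S ∣ ℕ.+ ∣ closedN G (∁ S) I ∣
  ∣closedN∣-split I = trans (∣p∣≡∣p∩q∣+∣p─q∣ (closedN G ⊤ I) S)
    (cong (λ X → ∣ closedN G ⊤ I ∩ S ∣ ℕ.+ ∣ X ∣) (sym (closedN-∁ I)))

  ∣closedN-∁∣ : ∀ I → + ∣ closedN G (∁ S) I ∣ ≡ + ∣ closedN G ⊤ I ∣ ℤ.- + ∣ closedN G ⊤ I ∩ S ∣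
  ∣closedN-∁∣ I = trans (sym (+[m+n]-+m≡+n ∣ closedN G ⊤ I ∩ S ∣ ∣ closedN G (∁ S) I ∣))
    (cong (λ k → + k ℤ.- + ∣ closedN G ⊤ I ∩ S ∣) (sym (∣closedN∣-split I)))

  aH-∁ : ∀ I → + aH G (∁ S) I ≡ + aH G ⊤ I ℤ.- (+ ∣ S ∣ ℤ.- + ∣ closedN G ⊤ I ∩ S ∣)
  aH-∁ I = begin
    + ∣ ∁ S ─ closedN G (∁ S) I ∣             ≡⟨ cong (λ X → + ∣ X ∣) ∁S─C′≡D─S ⟩
    + ∣ D ─ S ∣                                ≡⟨ sym (+[m+n]-+m≡+n ∣ D ∩ S ∣ ∣ D ─ S ∣) ⟩
    + (∣ D ∩ S ∣ ℕ.+ ∣ D ─ S ∣) ℤ.- + ∣ D ∩ S ∣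
      ≡⟨ cong₂ (λ d x → + d ℤ.- x) (sym (∣p∣≡∣p∩q∣+∣p─q∣ D S))
                                   (sym (+[m+n]-+m≡+n ∣ C ∩ S ∣ ∣ D ∩ S ∣)) ⟩
    + ∣ D ∣ ℤ.- (+ (∣ C ∩ S ∣ ℕ.+ ∣ D ∩ S ∣) ℤ.- + ∣ C ∩ S ∣)
      ≡⟨ cong (λ s → + ∣ D ∣ ℤ.- (+ s ℤ.- + ∣ C ∩ S ∣)) (sym ∣S∣-split) ⟩
    + ∣ D ∣ ℤ.- (+ ∣ S ∣ ℤ.- + ∣ C ∩ S ∣)     ∎
    where
    open ≡-Reasoning
    C D : Subset n
    C = closedN G ⊤ I
    D = ⊤ ─ C
    ∁S─C′≡D─S : ∁ S ─ closedN G (∁ S) I ≡ D ─ S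
    ∁S─C′≡D─S = trans (cong (∁ S ─_) (closedN-∁ I)) (lookup-ext pointwise)
      where
      neither : ∀ s c → not s ∧ not (c ∧ not s) ≡ not c ∧ not s
      neither true  c     = sym (∧-zeroʳ (not c))
      neither false true  = refl
      neither false false = refl
      pointwise : ∀ v → lookup (∁ S ─ (C ─ S)) v ≡ lookup (D ─ S) v
      pointwise v rewrite lookup-─ (∁ S) (C ─ S) v | lookup-∁ S v | lookup-─ C S v
                        | lookup-─ D S v | lookup-─ ⊤ C v | lookup-⊤ v =
        neither (lookup S v) (lookup C v)
    S─C≡D∩S : S ─ C ≡ D ∩ S
    S─C≡D∩S = lookup-ext pointwise
      where
      pointwise : ∀ v → lookup (S ─ C) v ≡ lookup (D ∩ S) v
      pointwise v rewrite lookup-─ S C v | lookup-∩ D S v | lookup-─ ⊤ C v | lookup-⊤ v =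
        ∧-comm (lookup S v) (not (lookup C v))
    ∣S∣-split : ∣ S ∣ ≡ ∣ C ∩ S ∣ ℕ.+ ∣ D ∩ S ∣
    ∣S∣-split = trans (∣p∣≡∣p∩q∣+∣p─q∣ S C) (cong₂ (λ X Y → ∣ X ∣ ℕ.+ ∣ Y ∣) (∩-comm S C) S─C≡D∩S)

  Δb-⊥ : Δb G S ⊥ ≡ 0ℚ
  Δb-⊥ = trans (cong₂ _-_ (bH-⊥ G (∁ S)) (bH-⊥ G ⊤)) (+-inverseʳ 1ℚ)

  Δb-solves : SolvesRecursion G (∁ S) (λ I → ℕ→ℚ ∣ closedN G ⊤ I ∩ S ∣ * bH G ⊤ I) (Δb G S)
  Δb-solves I ind ne = begin
    c′ * (b′ - b)
      ≡⟨ regroup c′ s b′ b ⟩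
    (c′ * b′ - (s + c′) * b) + s * b
      ≡⟨ cong₂ (λ x y → (x - y) + s * b) b′-rec b-rec ⟩
    (Σ∈ I (λ v → bH G (∁ S) (I ─ ⁅ v ⁆)) - Σ∈ I (λ v → bH G ⊤ (I ─ ⁅ v ⁆))) + s * b
      ≡⟨ cong (_+ s * b) (sym (Σ∈-- I _ _)) ⟩
    Σ∈ I (λ v → Δb G S (I ─ ⁅ v ⁆)) + s * b ∎
    where
    open ≡-Reasoning
    c′ s b′ b : ℚ
    c′ = ℕ→ℚ ∣ closedN G (∁ S) I ∣
    s  = ℕ→ℚ ∣ closedN G ⊤ I ∩ S ∣
    b′ = bH G (∁ S) I
    b  = bH G ⊤ I
    regroup : ∀ c s x y → c * (x - y) ≡ (c * x - (s + c) * y) + s * y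
    regroup = solve 4 (λ c s x y → c :* (x :- y) := (c :* x :- (s :+ c) :* y) :+ s :* y) refl
      where open ℚ-Solver.+-*-Solver
    b′-rec : c′ * b′ ≡ Σ∈ I (λ v → bH G (∁ S) (I ─ ⁅ v ⁆))
    b′-rec = bH-rec G (Independent⇒⊆ G {∁ S} ind) ne
    b-rec : (s + c′) * b ≡ Σ∈ I (λ v → bH G ⊤ (I ─ ⁅ v ⁆))
    b-rec = begin
      (s + c′) * b
        ≡⟨ cong (_* b) (sym (ℕ→ℚ-+ ∣ closedN G ⊤ I ∩ S ∣ ∣ closedN G (∁ S) I ∣)) ⟩
      ℕ→ℚ (∣ closedN G ⊤ I ∩ S ∣ ℕ.+ ∣ closedN G (∁ S) I ∣) * b
        ≡⟨ cong (λ k → ℕ→ℚ k * b) (sym (∣closedN∣-split I)) ⟩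
      ℕ→ℚ ∣ closedN G ⊤ I ∣ * b
        ≡⟨ bH-rec G (λ _ → ∈⊤) ne ⟩
      Σ∈ I (λ v → bH G ⊤ (I ─ ⁅ v ⁆)) ∎

  P-decomposition : ∀ k → P G ⊤ k ≡ (P G (∁ S) k - R G S k) + U G S k
  P-decomposition k = begin
    ΣSub (λ I → wH G ⊤ I when isIndep G ⊤ I ∧ e I)
      ≡⟨ ΣList-cong (allSubsets n) termwise ⟩
    ΣSub (λ I → (p′ I - r I) + u I)
      ≡⟨ ΣList-+ (allSubsets n) (λ I → p′ I - r I) u ⟩
    ΣSub (λ I → p′ I - r I) + ΣSub u
      ≡⟨ cong (_+ ΣSub u) (ΣList-- (allSubsets n) p′ r) ⟩
    (ΣSub p′ - ΣSub r) + ΣSub u ∎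
    where
    open ≡-Reasoning
    e : Subset n → Bool
    e I = ∣ I ∣ ℕ.≡ᵇ k
    p′ r u : Subset n → ℚ
    p′ I = wH G (∁ S) I when isIndep G (∁ S) I ∧ e I
    r  I = (wH G (∁ S) I - wH G ⊤ I) when isIndep G (∁ S) I ∧ e I
    u  I = wH G ⊤ I when (isIndep G ⊤ I ∧ meets I S) ∧ e I
    termwise : ∀ I → wH G ⊤ I when isIndep G ⊤ I ∧ e I ≡ (p′ I - r I) + u I
    termwise I = trans (when-split (isIndep G ⊤ I) (meets I S) (e I) (wH G ⊤ I) (wH G (∁ S) I))
      (cong (λ b → ((wH G (∁ S) I when b ∧ e I) - ((wH G (∁ S) I - wH G ⊤ I) when b ∧ e I)) + u I)
            (sym (isIndep-∁ I)))

theorem5p4 : ∀ {n} (G : SimpleGraph n) (S : Subset n) →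
  -- P_G(x) = P_{G'}(x) - R_S(x) + U_S(x), coefficientwise (G' = G[∁ S])
  (∀ k → P G ⊤ k ≡ (P G (∁ S) k - R G S k) + U G S k)
  -- (i) 𝓘(G') = { I ∈ 𝓘(G) : I ∩ S = ∅ }
  × (∀ I → (Independent G (∁ S) I → Independent G ⊤ I × Empty (I ∩ S))
         × (Independent G ⊤ I × Empty (I ∩ S) → Independent G (∁ S) I))
  -- (ii)
  × (∀ I → Independent G (∁ S) I →
       (+ ∣ closedN G (∁ S) I ∣ ≡ + ∣ closedN G ⊤ I ∣ ℤ.- + ∣ closedN G ⊤ I ∩ S ∣)
       × (+ aH G (∁ S) I ≡ + aH G ⊤ I ℤ.- (+ ∣ S ∣ ℤ.- + ∣ closedN G ⊤ I ∩ S ∣)))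
  -- (iii) Δb_∅ = 0 and the recursion for Δb
  × (Δb G S ⊥ ≡ 0ℚ)
  × (∀ I → Independent G (∁ S) I → Nonempty I →
       ℕ→ℚ ∣ closedN G (∁ S) I ∣ * Δb G S I
         ≡ Σ∈ I (λ v → Δb G S (I ─ ⁅ v ⁆)) + ℕ→ℚ ∣ closedN G ⊤ I ∩ S ∣ * bH G ⊤ I)
  -- ... and Δb is the unique solution of this recursion on 𝓘(G')
  × (∀ (f : Subset n → ℚ) → f ⊥ ≡ 0ℚ →
       (∀ I → Independent G (∁ S) I → Nonempty I →
          ℕ→ℚ ∣ closedN G (∁ S) I ∣ * f I
            ≡ Σ∈ I (λ v → f (I ─ ⁅ v ⁆)) + ℕ→ℚ ∣ closedN G ⊤ I ∩ S ∣ * bH G ⊤ I) →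
       ∀ I → Independent G (∁ S) I → f I ≡ Δb G S I)
theorem5p4 G S =
    P-decomposition G S
  , (λ I → to (Independent-∁⇔ G S) , from (Independent-∁⇔ G S))
  , (λ I _ → ∣closedN-∁∣ G S I , aH-∁ G S I)
  , Δb-⊥ G S
  , Δb-solves G S
  , λ f f⊥≡0 f-solves →
      recursion-unique G {∁ S} f-solves (Δb-solves G S) (trans f⊥≡0 (sym (Δb-⊥ G S)))
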